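{- Let $S=\{0,\tfrac14,\tfrac38,\tfrac12,\tfrac12+*,\tfrac58,\tfrac34,1\}$ (a set of normal-play partizan games). Then $\{\psi(G): G\in\mathcal{W}_{\{0,1\}},\ \pi(G)=0\}=\{\int_1^{1/2}x: x\in S\}$ and $\{\psi(G): G\in\mathcal{W}_{\{0,1\}},\ \pi(G)=1\}=\{*+\int_1^{1/2}x: x\in S\}$, and consequently $\psi(\mathcal{W}_{\{0,1\}})=\{\int_1^{1/2}x: x\in S\}\cup\{*+\int_1^{1/2}x: x\in S\}$; this set also equals $\psi(\mathcal{I}_{\{0,1\}})$. Moreover, the two sets $\{\int_1^{1/2}x: x\in S\}$ and $\{*+\int_1^{1/2}x: x\in S\}$ are disjoint. (All sets are sets of partizan game values.)
   Context: A well-tempered scoring game is defined recursively: an even-tempered game is either an integer or a pair $\{G^L|G^R\}$ with finite nonempty sets of odd-tempered left and right options; an odd-tempered game is a pair $\{G^L|G^R\}$ with finite nonempty sets of even-tempered options. Integers have no options. $\pi(G)=0$ for even-tempered, $1$ for odd-tempered games. Subgames: $G$ and subgames of its options; $\mathcal{W}_{\{0,1\}}$ is the class of games all of whose integer subgames lie in $\{0,1\}$. Outcomes: $\operatorname{L}(n)=\operatorname{R}(n)=n$ for integers, otherwise $\operatorname{L}(G)=\max_{G^L}\operatorname{R}(G^L)$, $\operatorname{R}(G)=\min_{G^R}\operatorname{L}(G^R)$. $\operatorname{gap}_0(G)$ is the supremum of $\operatorname{R}(K)-\operatorname{L}(K)$ over even-tempered subgames $K$ of $G$; $\mathcal{I}_{\{0,1\}}$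 is the class of games in $\mathcal{W}_{\{0,1\}}$ with $\operatorname{gap}_0=0$. The map $\psi$ to normal-play partizan games: $\psi(n)=n$ for integers, $\psi(\{G^L|G^R\})=\{\psi(G^L)|\psi(G^R)\}$. The overheating operation on partizan games is defined recursively on forms by $\int_1^{1/2}G=\{\int_1^{1/2}G^L+\tfrac12\mid\int_1^{1/2}G^R-\tfrac12\}$, and is well defined on values. $*=\{0|0\}$. -}

module Defs where

open import Data.Nat using (ℕ; zero; suc; _+_)
open import Data.Fin using (Fin; zero; suc; splitAt)
open import Data.Integer as ℤ using (ℤ; +_; -[1+_]; _⊔_; _⊓_)
open import Data.Sum using (_⊎_; [_,_]′)
open import Data.Product using (Σ; ∃; _×_; _,_)
open import Data.List using (List; []; _∷_; length; lookup)
open import Relation.Nullary using (¬_)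
open import Relation.Binary.PropositionalEquality using (_≡_)

data PG : Set where
  mk : (m : ℕ) → (Fin m → PG) → (n : ℕ) → (Fin n → PG) → PG

⟨_∣_⟩ : List PG → List PG → PG
⟨ ls ∣ rs ⟩ = mk (length ls) (lookup ls) (length rs) (lookup rs)

_≤G_ : PG → PG → Set
mk m L n R ≤G mk m' L' n' R' =
  ((i : Fin m) → ¬ (mk m' L' n' R' ≤G L i)) ×
  ((j : Fin n') → ¬ (R' j ≤G mk m L n R))

_≈G_ : PG → PG → Set
G ≈G H = (G ≤G H) × (H ≤G G)

_⊕_ : PG → PG → PG
mk m L n R ⊕ mk m' L' n' R' =
  mk (m + m') (λ k → [ (λ i → L i ⊕ mk m' L' n' R') , (λ i → mk m L n R ⊕ L' i) ]′ (splitAt m k))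
     (n + n') (λ k → [ (λ j → R j ⊕ mk m' L' n' R') , (λ j → mk m L n R ⊕ R' j) ]′ (splitAt n k))

⊖_ : PG → PG
⊖ mk m L n R = mk n (λ j → ⊖ R j) m (λ i → ⊖ L i)

natPG : ℕ → PG
natPG zero    = ⟨ [] ∣ [] ⟩
natPG (suc k) = ⟨ natPG k ∷ [] ∣ [] ⟩

intPG : ℤ → PG
intPG (+ k)      = natPG k
intPG -[1+ k ]   = ⊖ natPG (suc k)

zeroG oneG star half quarter threeEighths fiveEighths threeQuarters : PG
zeroG         = intPG (+ 0)
oneG          = intPG (+ 1)
star          = ⟨ zeroG ∷ [] ∣ zeroG ∷ [] ⟩
half          = ⟨ zeroG ∷ [] ∣ oneG ∷ [] ⟩
quarter       = ⟨ zeroG ∷ [] ∣ half ∷ [] ⟩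
threeQuarters = ⟨ half ∷ [] ∣ oneG ∷ [] ⟩
threeEighths  = ⟨ quarter ∷ [] ∣ half ∷ [] ⟩
fiveEighths   = ⟨ half ∷ [] ∣ threeQuarters ∷ [] ⟩

-- overheating  ∫_1^{1/2} G = { ∫G^L + 1/2 | ∫G^R - 1/2 }  (recursively on forms)
overheat : PG → PG
overheat (mk m L n R) = mk m (λ i → overheat (L i) ⊕ half) n (λ j → overheat (R j) ⊕ (⊖ half))

S : Fin 8 → PG
S = lookup (zeroG ∷ quarter ∷ threeEighths ∷ half ∷ (half ⊕ star) ∷ fiveEighths ∷ threeQuarters ∷ oneG ∷ [])

-- Well-tempered scoring games, indexed by their tempo (π = 0 even, π = 1 odd)

data Tempo : Set where
  even odd : Tempo

flipT : Tempo → Tempo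
flipT even = odd
flipT odd  = even

data WT : Tempo → Set where
  int : ℤ → WT even
  opt : ∀ {p} (m : ℕ) → (Fin (suc m) → WT (flipT p)) → (n : ℕ) → (Fin (suc n) → WT (flipT p)) → WT p

π : ∀ {p} → WT p → Tempo
π {p} _ = p

In01 : ∀ {p} → WT p → Set
In01 (int z)       = (z ≡ + 0) ⊎ (z ≡ + 1)
In01 (opt m L n R) = ((i : Fin (suc m)) → In01 (L i)) × ((j : Fin (suc n)) → In01 (R j))

maxF : (m : ℕ) → (Fin (suc m) → ℤ) → ℤ
maxF zero    f = f zero
maxF (suc m) f = f zero ⊔ maxF m (λ i → f (suc i))

minF : (m : ℕ) → (Fin (suc m) → ℤ) → ℤ
minF zero    f = f zero
minF (suc m) f = f zero ⊓ minF m (λ i → f (suc i))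

Lout Rout : ∀ {p} → WT p → ℤ
Lout (int z)       = z
Lout (opt m L n R) = maxF m (λ i → Rout (L i))
Rout (int z)       = z
Rout (opt m L n R) = minF n (λ j → Lout (R j))

-- gap_0(G) = sup { R(K) - L(K) : K an even-tempered subgame of G }
-- (the subgames of G are G and the subgames of its options; the supremum over
-- this finite nonempty set is computed recursively)
gap0 : ∀ {p} → WT p → ℤ
gap0 (int z)              = Rout (int z) ℤ.- Lout (int z)
gap0 (opt {even} m L n R) =
  (Rout (opt {even} m L n R) ℤ.- Lout (opt {even} m L n R))
    ⊔ (maxF m (λ i → gap0 (L i)) ⊔ maxF n (λ j → gap0 (R j)))
gap0 (opt {odd} m L n R)  = maxF m (λ i → gap0 (L i)) ⊔ maxF n (λ j → gap0 (R j))

InI01 : ∀ {p} → WT p → Set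
InI01 G = In01 G × (gap0 G ≡ + 0)

ψ : ∀ {p} → WT p → PG
ψ (int z)       = intPG z
ψ (opt m L n R) = mk (suc m) (λ i → ψ (L i)) (suc n) (λ j → ψ (R j))

-- Sets of game values, presented as families A → PG; two families describe the
-- same set of values iff every member of each is equal (as a value) to a member
-- of the other.
SameValues : {A B : Set} → (A → PG) → (B → PG) → Set
SameValues {A} {B} f g =
  ((a : A) → ∃ λ (b : B) → f a ≈G g b) × ((b : B) → ∃ λ (a : A) → f a ≈G g b)

_∪F_ : {A B : Set} → (A → PG) → (B → PG) → (A ⊎ B → PG)
f ∪F g = [ f , g ]′

W01 : Tempo → Set
W01 p = Σ (WT p) In01

ψW01 : ∀ p → W01 p → PG
ψW01 p (G , _) = ψ G

W01all : Set
W01all = Σ Tempo W01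

ψW01all : W01all → PG
ψW01all (p , G , _) = ψ G

I01all : Set
I01all = Σ Tempo λ p → Σ (WT p) InI01

ψI01all : I01all → PG
ψI01all (p , G , _) = ψ G

overheatS : Fin 8 → PG
overheatS i = overheat (S i)

starOverheatS : Fin 8 → PG
starOverheatS i = star ⊕ overheat (S i)

-- Every ψ-value of a game in W_{0,1} is one of eight values per tempo.  By induction, the
-- options of G have values among the eight of the opposite tempo; these are ordered like
-- their indices except that classes 3 and 4 are incomparable, so after removing dominated
-- options only the largest left class (plus class 3 if present) and the smallest right
-- class (plus class 4 if present) remain.  Each of the finitely many games so obtained is
-- equal to one of the eight values, and each value is realised by an explicit game of
-- I_{0,1}.  All finite comparisons are decided by the decidable Conway order.

module Submission where

open import Defs
open import Data.Bool using (Bool; true; false; if_then_else_)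
open import Data.Fin using (Fin; zero; suc; #_; _≤_)
open import Data.Fin.Properties using (_≟_; _≤?_; all?; any?; ≤-totalOrder)
open import Data.Integer using (+_)
import Data.Integer.Properties as ℤ
open import Data.List using (tabulate)
open import Data.List.Membership.Propositional.Properties using (∈-tabulate⁻)
open import Data.List.Relation.Unary.All.Properties using (tabulate⁻)
open import Data.Nat using (suc)
open import Data.Product using (∃; _×_; _,_; proj₁; proj₂)
open import Data.Sum using (inj₁; inj₂)
open import Data.Vec.Functional using (Vector; []; _∷_)
open import Function using (_∘_; id)
open import Relation.Binary.Bundles using (TotalOrder; Setoid)
import Relation.Binary.Reasoning.Setoid as SetoidReasoning
open import Relation.Binary.PropositionalEquality using (_≡_; refl; sym; trans; cong)
open import Relation.Nullary using (¬_; Dec; yes; no; does)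
open import Relation.Nullary.Decidable
  using (from-yes; map′; dec-true; ¬?; _×-dec_; _⊎-dec_; _→-dec_)

≤G-left : ∀ {m L n R} H → mk m L n R ≤G H → ∀ i → ¬ (H ≤G L i)
≤G-left (mk _ _ _ _) = proj₁

≤G-right : ∀ {m L n R} G → G ≤G mk m L n R → ∀ j → ¬ (R j ≤G G)
≤G-right (mk _ _ _ _) = proj₂

≤G-refl : ∀ G → G ≤G G
≤G-refl (mk m L n R) =
  (λ i L≤Lᵢ → ≤G-left (L i) L≤Lᵢ i (≤G-refl (L i))) ,
  (λ j Rⱼ≤R → ≤G-right (R j) Rⱼ≤R j (≤G-refl (R j)))

≤G-trans : ∀ G H K → G ≤G H → H ≤G K → G ≤G K
≤G-trans (mk m L n R) H@(mk _ _ _ _) (mk m″ L″ n″ R″) (G≤H₁ , G≤H₂) (H≤K₁ , H≤K₂) =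
  (λ i K≤Lᵢ → G≤H₁ i (≤G-trans H (mk m″ L″ n″ R″) (L i) (H≤K₁ , H≤K₂) K≤Lᵢ)) ,
  (λ j K″ⱼ≤G → H≤K₂ j (≤G-trans (R″ j) (mk m L n R) H K″ⱼ≤G (G≤H₁ , G≤H₂)))

G≰Gᴸ : ∀ {m L n R} i → ¬ (mk m L n R ≤G L i)
G≰Gᴸ {L = L} i G≤Lᵢ = ≤G-left (L i) G≤Lᵢ i (≤G-refl (L i))

Gᴿ≰G : ∀ {m L n R} j → ¬ (R j ≤G mk m L n R)
Gᴿ≰G {R = R} j Rⱼ≤G = ≤G-right (R j) Rⱼ≤G j (≤G-refl (R j))

≡⇒≤G : ∀ {G H} → G ≡ H → G ≤G H
≡⇒≤G {G} refl = ≤G-refl G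

≈G-refl : ∀ G → G ≈G G
≈G-refl G = ≤G-refl G , ≤G-refl G

≈G-sym : ∀ {G H} → G ≈G H → H ≈G G
≈G-sym (G≤H , H≤G) = H≤G , G≤H

≈G-trans : ∀ G H K → G ≈G H → H ≈G K → G ≈G K
≈G-trans G H K (G≤H , H≤G) (H≤K , K≤H) = ≤G-trans G H K G≤H H≤K , ≤G-trans K H G K≤H H≤G

≤G-options : ∀ {m L n R m′ L′ n′ R′} →
             (∀ i → ∃ λ i′ → L i ≤G L′ i′) → (∀ j′ → ∃ λ j → R j ≤G R′ j′) →
             mk m L n R ≤G mk m′ L′ n′ R′
≤G-options {m} {L} {n} {R} {m′} {L′} {n′} {R′} L≤L′ R≤R′ =
  (λ i H≤Lᵢ → let i′ , Lᵢ≤L′ = L≤L′ i in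
     G≰Gᴸ {m′} {L′} {n′} {R′} i′ (≤G-trans _ (L i) _ H≤Lᵢ Lᵢ≤L′)) ,
  (λ j′ R′ⱼ≤G → let j , Rⱼ≤R′ = R≤R′ j′ in
     Gᴿ≰G {m} {L} {n} {R} j (≤G-trans _ (R′ j′) _ Rⱼ≤R′ R′ⱼ≤G))

≈G-options : ∀ {m L L′ n R R′} → (∀ i → L i ≈G L′ i) → (∀ j → R j ≈G R′ j) →
             mk m L n R ≈G mk m L′ n R′
≈G-options L≈L′ R≈R′ =
  ≤G-options (λ i → i , proj₁ (L≈L′ i)) (λ j → j , proj₁ (R≈R′ j)) ,
  ≤G-options (λ i → i , proj₂ (L≈L′ i)) (λ j → j , proj₂ (R≈R′ j))

≈G-removeDominated :
  ∀ {m L n R m′ L′ n′ R′} →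
  (∀ i → ∃ λ i′ → L i ≤G L′ i′) → (∀ i′ → ∃ λ i → L i ≡ L′ i′) →
  (∀ j → ∃ λ j′ → R′ j′ ≤G R j) → (∀ j′ → ∃ λ j → R j ≡ R′ j′) →
  mk m L n R ≈G mk m′ L′ n′ R′
≈G-removeDominated L≤L′ L′⊆L R′≤R R′⊆R =
  ≤G-options L≤L′ (λ j′ → let j , eq = R′⊆R j′ in j , ≡⇒≤G eq) ,
  ≤G-options (λ i′ → let i , eq = L′⊆L i′ in i , ≡⇒≤G (sym eq)) R′≤R

≈G-setoid : Setoid _ _
≈G-setoid = record
  { Carrier       = PG
  ; _≈_           = _≈G_
  ; isEquivalence = record
    { refl  = λ {G} → ≈G-refl G
    ; sym   = ≈G-sym
    ; trans = λ {G} {H} {K} → ≈G-trans G H K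
    }
  }

open SetoidReasoning ≈G-setoid

_≤G?_ : (G H : PG) → Dec (G ≤G H)
mk m L n R ≤G? mk m′ L′ n′ R′ =
  all? (λ i → ¬? (mk m′ L′ n′ R′ ≤G? L i)) ×-dec all? (λ j → ¬? (R′ j ≤G? mk m L n R))

_≈G?_ : (G H : PG) → Dec (G ≈G H)
G ≈G? H = (G ≤G? H) ×-dec (H ≤G? G)

module FamilyExtrema {c ℓ₁ ℓ₂} (O : TotalOrder c ℓ₁ ℓ₂) where
  open TotalOrder O using (Carrier) renaming (_≤_ to _≼_)
  open import Data.List.Extrema O using (max; min; xs≤max; min≤xs; argmax-sel; argmin-sel)

  maxOf minOf : ∀ {m} → (Fin (suc m) → Carrier) → Carrier
  maxOf f = max (f zero) (tabulate f)
  minOf f = min (f zero) (tabulate f)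

  maxOf-upper : ∀ {m} (f : Fin (suc m) → Carrier) i → f i ≼ maxOf f
  maxOf-upper f = tabulate⁻ (xs≤max (f zero) (tabulate f))

  minOf-lower : ∀ {m} (f : Fin (suc m) → Carrier) i → minOf f ≼ f i
  minOf-lower f = tabulate⁻ (min≤xs (f zero) (tabulate f))

  maxOf-attained : ∀ {m} (f : Fin (suc m) → Carrier) → ∃ λ i → f i ≡ maxOf f
  maxOf-attained f with argmax-sel id (f zero) (tabulate f)
  ... | inj₁ max≡f₀ = zero , sym max≡f₀
  ... | inj₂ max∈f  = let i , max≡fᵢ = ∈-tabulate⁻ {f = f} max∈f in i , sym max≡fᵢ

  minOf-attained : ∀ {m} (f : Fin (suc m) → Carrier) → ∃ λ i → f i ≡ minOf f
  minOf-attained f with argmin-sel id (f zero) (tabulate f)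
  ... | inj₁ min≡f₀ = zero , sym min≡f₀
  ... | inj₂ min∈f  = let i , min≡fᵢ = ∈-tabulate⁻ {f = f} min∈f in i , sym min≡fᵢ

Class : Set
Class = Fin 8

three four : Class
three = # 3
four  = # 4

⟪_∣_⟫ : ∀ {p} → WT (flipT p) → WT (flipT p) → WT p
⟪ a ∣ b ⟫ = opt 0 (λ _ → a) 0 (λ _ → b)

𝟘 𝟙 : WT even
𝟘 = int (+ 0)
𝟙 = int (+ 1)

½ : WT odd
½ = ⟪ 𝟘 ∣ 𝟙 ⟫

witness : (p : Tempo) → Class → WT p
witness even = 𝟘 ∷ ⟪ ½ ∣ ⟪ 𝟘 ∣ 𝟘 ⟫ ⟫ ∷ ⟪ ⟪ 𝟙 ∣ ⟪ ½ ∣ ½ ⟫ ⟫ ∣ ⟪ 𝟘 ∣ 𝟘 ⟫ ⟫ ∷ ⟪ ½ ∣ ½ ⟫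
             ∷ ⟪ ⟪ 𝟙 ∣ 𝟙 ⟫ ∣ ⟪ 𝟘 ∣ 𝟘 ⟫ ⟫ ∷ ⟪ ⟪ 𝟙 ∣ 𝟙 ⟫ ∣ ⟪ ⟪ ½ ∣ ½ ⟫ ∣ 𝟘 ⟫ ⟫ ∷ ⟪ ⟪ 𝟙 ∣ 𝟙 ⟫ ∣ ½ ⟫ ∷ 𝟙 ∷ []
witness odd  = ⟪ 𝟘 ∣ 𝟘 ⟫ ∷ ⟪ ⟪ ½ ∣ ½ ⟫ ∣ 𝟘 ⟫ ∷ ⟪ ⟪ ⟪ 𝟙 ∣ 𝟙 ⟫ ∣ ½ ⟫ ∣ 𝟘 ⟫ ∷ ½
             ∷ ⟪ 𝟙 ∣ 𝟘 ⟫ ∷ ⟪ 𝟙 ∣ ⟪ ½ ∣ ⟪ 𝟘 ∣ 𝟘 ⟫ ⟫ ⟫ ∷ ⟪ 𝟙 ∣ ⟪ ½ ∣ ½ ⟫ ⟫ ∷ ⟪ 𝟙 ∣ 𝟙 ⟫ ∷ []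

value : Tempo → Class → PG
value p k = ψ (witness p k)

target : Tempo → Class → PG
target even = overheatS
target odd  = starOverheatS

InI01? : ∀ {p} (G : WT p) → Dec (InI01 G)
InI01? G = In01? G ×-dec (gap0 G ℤ.≟ + 0)
  where
  In01? : ∀ {p} (G : WT p) → Dec (In01 G)
  In01? (int z)       = (z ℤ.≟ + 0) ⊎-dec (z ℤ.≟ + 1)
  In01? (opt m L n R) = all? (In01? ∘ L) ×-dec all? (In01? ∘ R)

witness∈I01 : ∀ p k → InI01 (witness p k)
witness∈I01 even = from-yes (all? (InI01? ∘ witness even))
witness∈I01 odd  = from-yes (all? (InI01? ∘ witness odd))

value≈target : ∀ p k → value p k ≈G target p k
value≈target even = from-yes (all? λ k → value even k ≈G? target even k)
value≈target odd  = from-yes (all? λ k → value odd k ≈G? target odd k)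

value-disjoint : ∀ i j → ¬ (value even i ≈G value odd j)
value-disjoint = from-yes (all? λ i → all? λ j → ¬? (value even i ≈G? value odd j))

-- Classes 3 and 4 come from the incomparable elements 1/2 and 1/2 + * of S.
ValuesOrdered : Tempo → Set
ValuesOrdered p = ∀ a x → a ≤ x → ¬ (a ≡ three × x ≡ four) → value p a ≤G value p x

values-ordered? : ∀ p → Dec (ValuesOrdered p)
values-ordered? p = all? λ a → all? λ x →
  (a ≤? x) →-dec ¬? ((a ≟ three) ×-dec (x ≟ four)) →-dec (value p a ≤G? value p x)

values-ordered : ∀ p → ValuesOrdered p
values-ordered even = from-yes (values-ordered? even)
values-ordered odd  = from-yes (values-ordered? odd)

open FamilyExtrema (≤-totalOrder 8)

game : ∀ {m n} → Tempo → Vector Class m → Vector Class n → PG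
game q f g = mk _ (value q ∘ f) _ (value q ∘ g)

has : ∀ {m} → Class → Vector Class m → Bool
has t f = does (any? λ i → f i ≟ t)

has-intro : ∀ {m t} (f : Vector Class m) i → f i ≡ t → has t f ≡ true
has-intro {t = t} f i fᵢ≡t = dec-true (any? λ i → f i ≟ t) (i , fᵢ≡t)

has-elim : ∀ {m t} (f : Vector Class m) → has t f ≡ true → ∃ λ i → f i ≡ t
has-elim {t = t} f has≡true with any? (λ i → f i ≟ t) | has≡true
... | yes t∈f | _  = t∈f
... | no  _   | ()

pairWith : Class → Bool → Class → Vector Class 2
pairWith t b x = x ∷ (if b then t else x) ∷ []

tops : ∀ {m} → Vector Class (suc m) → Vector Class 2
tops f = pairWith three (has three f) (maxOf f)

bottoms : ∀ {n} → Vector Class (suc n) → Vector Class 2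
bottoms g = pairWith four (has four g) (minOf g)

tops-dominate : ∀ q {m} (f : Vector Class (suc m)) i → ∃ λ i′ → value q (f i) ≤G value q (tops f i′)
tops-dominate q f i with f i ≟ three ×-dec maxOf f ≟ four
... | no unexceptional = zero , values-ordered q (f i) (maxOf f) (maxOf-upper f i) unexceptional
... | yes (fᵢ≡3 , _)   = suc zero , ≡⇒≤G (cong (value q)
        (trans fᵢ≡3 (cong (λ b → if b then three else maxOf f) (sym (has-intro f i fᵢ≡3)))))

bottoms-dominate : ∀ q {n} (g : Vector Class (suc n)) j → ∃ λ j′ → value q (bottoms g j′) ≤G value q (g j)
bottoms-dominate q g j with minOf g ≟ three ×-dec g j ≟ four
... | no unexceptional = zero , values-ordered q (minOf g) (g j) (minOf-lower g j) unexceptional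
... | yes (_ , gⱼ≡4)   = suc zero , ≡⇒≤G (cong (value q)
        (trans (cong (λ b → if b then four else minOf g) (has-intro g j gⱼ≡4)) (sym gⱼ≡4)))

pairWith-attained : ∀ {m t b x} (f : Vector Class m) →
                    (b ≡ true → ∃ λ i → f i ≡ t) → (∃ λ i → f i ≡ x) →
                    ∀ i′ → ∃ λ i → f i ≡ pairWith t b x i′
pairWith-attained             f _   x∈f zero       = x∈f
pairWith-attained {b = true}  f t∈f _   (suc zero) = t∈f refl
pairWith-attained {b = false} f _   x∈f (suc zero) = x∈f

tops-attained : ∀ {m} (f : Vector Class (suc m)) i′ → ∃ λ i → f i ≡ tops f i′
tops-attained f = pairWith-attained f (has-elim f) (maxOf-attained f)

bottoms-attained : ∀ {n} (g : Vector Class (suc n)) j′ → ∃ λ j → g j ≡ bottoms g j′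
bottoms-attained g = pairWith-attained g (has-elim g) (minOf-attained g)

game≈game-tops-bottoms : ∀ q {m n} (f : Vector Class (suc m)) (g : Vector Class (suc n)) →
                         game q f g ≈G game q (tops f) (bottoms g)
game≈game-tops-bottoms q f g =
  ≈G-removeDominated (tops-dominate q f) (value-of ∘ tops-attained f)
                     (bottoms-dominate q g) (value-of ∘ bottoms-attained g)
  where
  value-of : ∀ {m} {h : Vector Class m} {k} → ∃ (λ i → h i ≡ k) → ∃ λ i → value q (h i) ≡ value q k
  value-of (i , hᵢ≡k) = i , cong (value q) hᵢ≡k

all-Bool? : ∀ {ℓ} {P : Bool → Set ℓ} → (∀ b → Dec (P b)) → Dec (∀ b → P b)
all-Bool? P? = map′ (λ (Pt , Pf) → λ { true → Pt ; false → Pf }) (λ ∀P → ∀P true , ∀P false)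
                    (P? true ×-dec P? false)

ReducedClassified : Tempo → Set
ReducedClassified p =
  ∀ x b y c → ∃ λ k → game (flipT p) (pairWith three b x) (pairWith four c y) ≈G value p k

reduced-classified? : ∀ p → Dec (ReducedClassified p)
reduced-classified? p = all? λ x → all-Bool? λ b → all? λ y → all-Bool? λ c → any? λ k →
  game (flipT p) (pairWith three b x) (pairWith four c y) ≈G? value p k

reduced-classified : ∀ p → ReducedClassified p
reduced-classified even = from-yes (reduced-classified? even)
reduced-classified odd  = from-yes (reduced-classified? odd)

classify : ∀ {p} (G : WT p) → In01 G → ∃ λ k → ψ G ≈G value p k
classify (int _) (inj₁ refl) = # 0 , ≈G-refl _
classify (int _) (inj₂ refl) = # 7 , ≈G-refl _
classify {p} (opt m L n R) (L∈ , R∈) = k , (begin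
  ψ (opt m L n R)                         ≈⟨ ≈G-options (proj₂ ∘ classL) (proj₂ ∘ classR) ⟩
  game (flipT p) f g                      ≈⟨ game≈game-tops-bottoms (flipT p) f g ⟩
  game (flipT p) (tops f) (bottoms g)     ≈⟨ reduced≈k ⟩
  value p k                               ∎)
  where
  classL = λ i → classify (L i) (L∈ i)
  classR = λ j → classify (R j) (R∈ j)
  f = proj₁ ∘ classL
  g = proj₁ ∘ classR
  reduced = reduced-classified p (maxOf f) (has three f) (minOf g) (has four g)
  k = proj₁ reduced
  reduced≈k = proj₂ reduced

ψ-classified : ∀ p (G : WT p) → In01 G → ∃ λ k → ψ G ≈G target p k
ψ-classified p G G∈ = let k , ψG≈k = classify G G∈ in k , (begin
  ψ G        ≈⟨ ψG≈k ⟩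
  value p k  ≈⟨ value≈target p k ⟩
  target p k ∎)

ψW01-values : ∀ p → SameValues (ψW01 p) (target p)
ψW01-values p =
  (λ (G , G∈) → ψ-classified p G G∈) ,
  (λ k → (witness p k , proj₁ (witness∈I01 p k)) , value≈target p k)

ψ-classified-∪ : ∀ p (G : WT p) → In01 G → ∃ λ u → ψ G ≈G (overheatS ∪F starOverheatS) u
ψ-classified-∪ even G G∈ = let k , ψG≈k = ψ-classified even G G∈ in inj₁ k , ψG≈k
ψ-classified-∪ odd  G G∈ = let k , ψG≈k = ψ-classified odd G G∈ in inj₂ k , ψG≈k

∪-realised : ∀ u → ∃ λ ((p , k) : Tempo × Class) → value p k ≈G (overheatS ∪F starOverheatS) u
∪-realised (inj₁ k) = (even , k) , value≈target even k
∪-realised (inj₂ k) = (odd , k) , value≈target odd k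

mainTheorem13 :
    SameValues (ψW01 even) overheatS
    × SameValues (ψW01 odd) starOverheatS
    × SameValues ψW01all (overheatS ∪F starOverheatS)
    × SameValues ψI01all (overheatS ∪F starOverheatS)
    × ((i j : Fin 8) → ¬ (overheatS i ≈G starOverheatS j))
mainTheorem13 =
  ψW01-values even ,
  ψW01-values odd ,
  ((λ (p , G , G∈) → ψ-classified-∪ p G G∈) ,
   (λ u → let (p , k) , k≈u = ∪-realised u in (p , witness p k , proj₁ (witness∈I01 p k)) , k≈u)) ,
  ((λ (p , G , G∈ , _) → ψ-classified-∪ p G G∈) ,
   (λ u → let (p , k) , k≈u = ∪-realised u in (p , witness p k , witness∈I01 p k) , k≈u)) ,
  λ i j overheat≈star → value-disjoint i j (begin
    value even i    ≈⟨ value≈target even i ⟩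
    overheatS i     ≈⟨ overheat≈star ⟩
    starOverheatS j ≈⟨ value≈target odd j ⟨
    value odd j     ∎)
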